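{- For an integer $k\ge 2$ let $q(k)=\sum_{i=1}^{k-1}\binom{k}{i}^{ -1}$. Then: (i) $q(k)<\frac{4}{k}$ for all $k\ge 2$; (ii) $q(k)\le\frac{2}{3}$ for all $k\ge 2$, with equality at $k=3$ and $k=4$; (iii) if $a,b\ge 2$ are integers with $a+b\ge 13$, then $q(a)+q(b)\le 1$. -}

module Defs where

open import Data.Nat using (ℕ; zero; suc; _∸_)
open import Data.Nat.Combinatorics using (_C_)
open import Data.Integer using (+_)
open import Data.Rational using (ℚ; 0ℚ; _/_; _+_)

-- reciprocal of a natural number as a rational; the value at 0 is a
-- junk value (0) that is never used: C(k,i) ≥ 1 for 1 ≤ i ≤ k-1.
recipℕ : ℕ → ℚ
recipℕ zero    = 0ℚ
recipℕ (suc n) = + 1 / suc n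

sumRecipBinom : ℕ → ℕ → ℚ
sumRecipBinom k zero    = 0ℚ
sumRecipBinom k (suc m) = sumRecipBinom k m + recipℕ (k C suc m)

q : ℕ → ℚ
q k = sumRecipBinom k (k ∸ 1)

-- Write k = n + 2.  The two extreme terms of q(k) are 1/k, and every middle
-- coefficient C(k,i), 2 ≤ i ≤ k − 2, is at least C(k,2) = k(k − 1)/2 (Pascal's
-- rule, by induction), so
--   q(k) ≤ 2/k + 2(k − 3)/(k(k − 1)) = 4(k − 2)/(k(k − 1)) < 4/k.
-- This is (i), and (ii) for k ≥ 6; the values k = 2, …, 5 are computed.  For
-- (iii), if a ≥ 12 then q(a) ≤ 4/12 = 1/3 and q(b) ≤ 2/3, and likewise with a
-- and b exchanged; the finitely many pairs with a, b < 12 are checked by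
-- evaluation.

module Submission where

module BinomialBounds where
  open import Data.Nat
  open import Data.Nat.Properties
  open import Data.Nat.Combinatorics
    using (_C_; nC1≡n; nCn≡1; nCk≡nC[n∸k]; nCk+nC[k+1]≡[n+1]C[k+1])
  open import Data.Nat.Tactic.RingSolver using (solve-∀; solve)
  open import Data.List using ([]; _∷_)
  open import Data.Product using (_,_)
  open import Relation.Binary.PropositionalEquality

  C-pascal : ∀ a b → (suc a + suc b) C suc a ≡ (a + suc b) C a + (suc a + b) C suc a
  C-pascal a b = begin-equality
    (suc a + suc b) C suc a                ≡⟨ cong (λ n → suc n C suc a) (+-suc a b) ⟩
    suc (suc a + b) C suc a                ≡⟨ nCk+nC[k+1]≡[n+1]C[k+1] (suc a + b) a ⟨
    (suc a + b) C a + (suc a + b) C suc a  ≡⟨ cong (λ n → n C a + (suc a + b) C suc a) (+-suc a b) ⟨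
    (a + suc b) C a + (suc a + b) C suc a  ∎
    where open ≤-Reasoning

  [a+b]Ca>0 : ∀ a b → 0 < (a + b) C a
  [a+b]Ca>0 zero    b       = s≤s z≤n
  [a+b]Ca>0 (suc a) zero    rewrite +-identityʳ a | nCn≡1 (suc a) = s≤s z≤n
  [a+b]Ca>0 (suc a) (suc b) rewrite C-pascal a b = ≤-trans ([a+b]Ca>0 a (suc b)) (m≤m+n _ _)

  a+b≤[a+b]Ca : ∀ a b → suc a + suc b ≤ (suc a + suc b) C suc a
  a+b≤[a+b]Ca zero    b = ≤-reflexive (sym (nC1≡n (2 + b)))
  a+b≤[a+b]Ca (suc a) b = begin
    suc (suc a + suc b)                              ≡⟨ +-comm 1 (suc a + suc b) ⟩
    suc a + suc b + 1                                ≤⟨ +-mono-≤ (a+b≤[a+b]Ca a b) ([a+b]Ca>0 (2 + a) b) ⟩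
    (suc a + suc b) C suc a + (2 + a + b) C (2 + a)  ≡⟨ C-pascal (suc a) b ⟨
    (2 + a + suc b) C (2 + a)                        ∎
    where open ≤-Reasoning

  C2≤[a+b]Ca : ∀ a b → (2 + a + (2 + b)) C 2 ≤ (2 + a + (2 + b)) C (2 + a)
  C2≤[a+b]Ca zero    b = ≤-refl
  C2≤[a+b]Ca (suc a) b = begin
    suc n C 2                                ≡⟨ nCk+nC[k+1]≡[n+1]C[k+1] n 1 ⟨
    n C 1 + n C 2                            ≡⟨ cong (_+ n C 2) (nC1≡n n) ⟩
    n + n C 2                                ≡⟨ cong (_+ n C 2) (+-suc (2 + a) (suc b)) ⟩
    suc (2 + a + suc b) + n C 2              ≤⟨ +-mono-≤ (a+b≤[a+b]Ca (2 + a) b) (C2≤[a+b]Ca a b) ⟩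
    (3 + a + suc b) C (3 + a) + n C (2 + a)  ≡⟨ +-comm _ (n C (2 + a)) ⟩
    n C (2 + a) + (3 + a + suc b) C (3 + a)  ≡⟨ C-pascal (2 + a) (suc b) ⟨
    suc n C (3 + a)                          ∎
    where
    open ≤-Reasoning
    n = 2 + a + (2 + b)

  C2≤C : ∀ {n k} → 2 ≤ k → 2 + k ≤ n → n C 2 ≤ n C k
  C2≤C {k = suc (suc a)} (s≤s (s≤s z≤n)) 2+k≤n with m≤n⇒∃[o]m+o≡n 2+k≤n
  ... | b , refl = subst (λ n → n C 2 ≤ n C (2 + a)) (reassoc a b) (C2≤[a+b]Ca a b)
    where
    reassoc : ∀ a b → 2 + a + (2 + b) ≡ 2 + (2 + a) + b
    reassoc = solve-∀

  2*[1+n]C2≡[1+n]*n : ∀ n → 2 * (suc n C 2) ≡ suc n * n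
  2*[1+n]C2≡[1+n]*n zero    = refl
  2*[1+n]C2≡[1+n]*n (suc n) = begin-equality
    2 * ((2 + n) C 2)                ≡⟨ cong (2 *_) (nCk+nC[k+1]≡[n+1]C[k+1] (suc n) 1) ⟨
    2 * (suc n C 1 + suc n C 2)      ≡⟨ cong (λ c → 2 * (c + suc n C 2)) (nC1≡n (suc n)) ⟩
    2 * (suc n + suc n C 2)          ≡⟨ *-distribˡ-+ 2 (suc n) (suc n C 2) ⟩
    2 * suc n + 2 * (suc n C 2)      ≡⟨ cong (2 * suc n +_) (2*[1+n]C2≡[1+n]*n n) ⟩
    2 * suc n + suc n * n            ≡⟨ solve (n ∷ []) ⟩
    (2 + n) * suc n                  ∎
    where open ≤-Reasoning

  [1+n]Cn≡1+n : ∀ n → suc n C n ≡ suc n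
  [1+n]Cn≡1+n n = begin-equality
    suc n C n            ≡⟨ nCk≡nC[n∸k] (n≤1+n n) ⟩
    suc n C (suc n ∸ n)  ≡⟨ cong (suc n C_) (m+n∸n≡m 1 n) ⟩
    suc n C 1            ≡⟨ nC1≡n (suc n) ⟩
    suc n                ∎
    where open ≤-Reasoning

open BinomialBounds

open import Defs
open import Data.Nat using (ℕ; _≥_)
open import Data.Nat as ℕ using ()
open import Data.Product using (_×_)
open import Data.Integer using (+_)
open import Data.Rational using (ℚ; _/_; _+_; _<_; _≤_; 1ℚ)
open import Relation.Binary.PropositionalEquality using (_≡_)

open import Data.Nat using (zero; suc; z≤n; s≤s)
open import Data.Nat.Properties as ℕ using (allUpTo?)
open import Data.Nat.Combinatorics using (_C_; nC1≡n)
open import Data.Nat.Tactic.RingSolver using (solve)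
open import Data.List using ([]; _∷_)
import Data.Integer as ℤ
open import Data.Integer.Properties using (pos-*; pos-+; *-distribʳ-+; *-assoc)
open import Data.Product using (_,_)
open import Data.Rational using (0ℚ; toℚᵘ; _≤?_; _<?_)
open import Data.Rational.Properties
  using (toℚᵘ-fromℚᵘ; toℚᵘ-cancel-≤; toℚᵘ-cancel-<; toℚᵘ-injective; toℚᵘ-homo-+;
         +-mono-≤; +-identityˡ; <⇒≤; ≤-reflexive; ≤-<-trans; <-≤-trans; module ≤-Reasoning)
import Data.Rational.Unnormalised as ℚᵘ
open import Data.Rational.Unnormalised.Properties
  using (≃-sym; ≃-trans; ≤-respˡ-≃; ≤-respʳ-≃; <-respˡ-≃; <-respʳ-≃; +-cong)
open import Relation.Binary.PropositionalEquality
  using (refl; sym; trans; cong; cong₂; subst; subst₂; module ≡-Reasoning)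
open import Relation.Nullary.Decidable using (yes; no; from-yes; _→-dec_)
open import Relation.Nullary.Negation using (contradiction)

toℚᵘ-/ : ∀ a b .{{_ : ℕ.NonZero b}} → toℚᵘ (+ a / b) ℚᵘ.≃ (+ a ℚᵘ./ b)
toℚᵘ-/ a (suc b) = toℚᵘ-fromℚᵘ (+ a ℚᵘ./ suc b)

*≤*⇒/≤/ : ∀ a b c d .{{_ : ℕ.NonZero b}} .{{_ : ℕ.NonZero d}} →
          a ℕ.* d ℕ.≤ c ℕ.* b → + a / b ≤ + c / d
*≤*⇒/≤/ a b@(suc _) c d@(suc _) ad≤cb = toℚᵘ-cancel-≤
  (≤-respˡ-≃ (≃-sym (toℚᵘ-/ a b)) (≤-respʳ-≃ (≃-sym (toℚᵘ-/ c d))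
    (ℚᵘ.*≤* (subst₂ ℤ._≤_ (pos-* a d) (pos-* c b) (ℤ.+≤+ ad≤cb)))))

*<*⇒/</ : ∀ a b c d .{{_ : ℕ.NonZero b}} .{{_ : ℕ.NonZero d}} →
          a ℕ.* d ℕ.< c ℕ.* b → + a / b < + c / d
*<*⇒/</ a b@(suc _) c d@(suc _) ad<cb = toℚᵘ-cancel-<
  (<-respˡ-≃ (≃-sym (toℚᵘ-/ a b)) (<-respʳ-≃ (≃-sym (toℚᵘ-/ c d))
    (ℚᵘ.*<* (subst₂ ℤ._<_ (pos-* a d) (pos-* c b) (ℤ.+<+ ad<cb)))))

*≡*⇒/≡/ : ∀ a b c d .{{_ : ℕ.NonZero b}} .{{_ : ℕ.NonZero d}} →
          a ℕ.* d ≡ c ℕ.* b → + a / b ≡ + c / d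
*≡*⇒/≡/ a b@(suc _) c d@(suc _) ad≡cb = toℚᵘ-injective
  (≃-trans (toℚᵘ-/ a b) (≃-trans
    (ℚᵘ.*≡* (trans (sym (pos-* a d)) (trans (cong +_ ad≡cb) (pos-* c b))))
    (≃-sym (toℚᵘ-/ c d))))

+-distrib-/ : ∀ a c d .{{_ : ℕ.NonZero d}} → + (a ℕ.+ c) / d ≡ + a / d + + c / d
+-distrib-/ a c d@(suc _) = toℚᵘ-injective
  (≃-trans (toℚᵘ-/ (a ℕ.+ c) d) (≃-trans (ℚᵘ.*≡* cross-multiplied)
    (≃-sym (≃-trans (toℚᵘ-homo-+ (+ a / d) (+ c / d)) (+-cong (toℚᵘ-/ a d) (toℚᵘ-/ c d))))))
  where
  cross-multiplied : + (a ℕ.+ c) ℤ.* + (d ℕ.* d) ≡ (+ a ℤ.* + d ℤ.+ + c ℤ.* + d) ℤ.* + d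
  cross-multiplied = begin
    + (a ℕ.+ c) ℤ.* + (d ℕ.* d)            ≡⟨ cong₂ ℤ._*_ (pos-+ a c) (pos-* d d) ⟩
    (+ a ℤ.+ + c) ℤ.* (+ d ℤ.* + d)        ≡⟨ sym (*-assoc (+ a ℤ.+ + c) (+ d) (+ d)) ⟩
    (+ a ℤ.+ + c) ℤ.* + d ℤ.* + d          ≡⟨ cong (ℤ._* + d) (*-distribʳ-+ (+ d) (+ a) (+ c)) ⟩
    (+ a ℤ.* + d ℤ.+ + c ℤ.* + d) ℤ.* + d  ∎
    where open ≡-Reasoning

recipℕ-≤ : ∀ x c d .{{_ : ℕ.NonZero d}} → d ℕ.≤ c ℕ.* x → recipℕ x ≤ + c / d
recipℕ-≤ zero    c (suc d) d≤c*0 = contradiction (subst (suc d ℕ.≤_) (ℕ.*-zeroʳ c) d≤c*0) λ ()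
recipℕ-≤ (suc x) c d       d≤cx  = *≤*⇒/≤/ 1 (suc x) c d (subst (ℕ._≤ c ℕ.* suc x) (sym (ℕ.*-identityˡ d)) d≤cx)

recipℕ-middle-C-≤ : ∀ n {i} → 2 ℕ.≤ i → 2 ℕ.+ i ℕ.≤ 2 ℕ.+ n →
                    recipℕ ((2 ℕ.+ n) C i) ≤ + 2 / ((2 ℕ.+ n) ℕ.* suc n)
recipℕ-middle-C-≤ n {i} 2≤i 2+i≤2+n = recipℕ-≤ ((2 ℕ.+ n) C i) 2 ((2 ℕ.+ n) ℕ.* suc n) (begin
  (2 ℕ.+ n) ℕ.* suc n    ≡⟨ 2*[1+n]C2≡[1+n]*n (suc n) ⟨
  2 ℕ.* ((2 ℕ.+ n) C 2)  ≤⟨ ℕ.*-monoʳ-≤ 2 (C2≤C 2≤i 2+i≤2+n) ⟩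
  2 ℕ.* ((2 ℕ.+ n) C i)  ∎)
  where open ℕ.≤-Reasoning

sumRecipBinom-≤ : ∀ n t → t ℕ.< n →
  sumRecipBinom (2 ℕ.+ n) (suc t) ≤ + (suc n ℕ.+ 2 ℕ.* t) / ((2 ℕ.+ n) ℕ.* suc n)
sumRecipBinom-≤ n zero _ = ≤-reflexive (begin
  0ℚ + recipℕ ((2 ℕ.+ n) C 1)  ≡⟨ +-identityˡ _ ⟩
  recipℕ ((2 ℕ.+ n) C 1)       ≡⟨ cong recipℕ (nC1≡n (2 ℕ.+ n)) ⟩
  + 1 / (2 ℕ.+ n)              ≡⟨ *≡*⇒/≡/ 1 (2 ℕ.+ n) (suc n ℕ.+ 2 ℕ.* 0) ((2 ℕ.+ n) ℕ.* suc n) (solve (n ∷ [])) ⟩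
  + (suc n ℕ.+ 2 ℕ.* 0) / ((2 ℕ.+ n) ℕ.* suc n) ∎)
  where open ≡-Reasoning
sumRecipBinom-≤ n (suc t) 2+t≤n = begin
  sumRecipBinom (2 ℕ.+ n) (suc t) + recipℕ ((2 ℕ.+ n) C (2 ℕ.+ t))
    ≤⟨ +-mono-≤ (sumRecipBinom-≤ n t (ℕ.<⇒≤ 2+t≤n))
                (recipℕ-middle-C-≤ n (s≤s (s≤s z≤n)) (s≤s (s≤s 2+t≤n))) ⟩
  + (suc n ℕ.+ 2 ℕ.* t) / D + + 2 / D
    ≡⟨ +-distrib-/ (suc n ℕ.+ 2 ℕ.* t) 2 D ⟨
  + (suc n ℕ.+ 2 ℕ.* t ℕ.+ 2) / D
    ≡⟨ cong (λ a → + a / D) {suc n ℕ.+ 2 ℕ.* t ℕ.+ 2} {suc n ℕ.+ 2 ℕ.* suc t} (solve (n ∷ t ∷ [])) ⟩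
  + (suc n ℕ.+ 2 ℕ.* suc t) / D ∎
  where
  open ≤-Reasoning
  D = (2 ℕ.+ n) ℕ.* suc n

q[3+n]≤4[1+n]/[3+n][2+n] : ∀ n → q (3 ℕ.+ n) ≤ + (4 ℕ.* suc n) / ((3 ℕ.+ n) ℕ.* (2 ℕ.+ n))
q[3+n]≤4[1+n]/[3+n][2+n] n = begin
  sumRecipBinom (3 ℕ.+ n) (suc n) + recipℕ ((3 ℕ.+ n) C (2 ℕ.+ n))
    ≡⟨ cong (λ c → sumRecipBinom (3 ℕ.+ n) (suc n) + recipℕ c) ([1+n]Cn≡1+n (2 ℕ.+ n)) ⟩
  sumRecipBinom (3 ℕ.+ n) (suc n) + + 1 / (3 ℕ.+ n)
    ≤⟨ +-mono-≤ (sumRecipBinom-≤ (suc n) n (ℕ.n<1+n n))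
                (≤-reflexive (*≡*⇒/≡/ 1 (3 ℕ.+ n) (2 ℕ.+ n) ((3 ℕ.+ n) ℕ.* (2 ℕ.+ n)) (solve (n ∷ [])))) ⟩
  + (2 ℕ.+ n ℕ.+ 2 ℕ.* n) / D + + (2 ℕ.+ n) / D
    ≡⟨ +-distrib-/ (2 ℕ.+ n ℕ.+ 2 ℕ.* n) (2 ℕ.+ n) D ⟨
  + (2 ℕ.+ n ℕ.+ 2 ℕ.* n ℕ.+ (2 ℕ.+ n)) / D
    ≡⟨ cong (λ a → + a / D) {2 ℕ.+ n ℕ.+ 2 ℕ.* n ℕ.+ (2 ℕ.+ n)} {4 ℕ.* suc n} (solve (n ∷ [])) ⟩
  + (4 ℕ.* suc n) / D ∎
  where
  open ≤-Reasoning
  D = (3 ℕ.+ n) ℕ.* (2 ℕ.+ n)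

q<4/k : ∀ k .{{_ : ℕ.NonZero k}} → k ≥ 2 → q k < + 4 / k
q<4/k 2 _ = from-yes (q 2 <? + 4 / 2)
q<4/k (suc (suc (suc n))) _ = ≤-<-trans (q[3+n]≤4[1+n]/[3+n][2+n] n)
  (*<*⇒/</ (4 ℕ.* suc n) ((3 ℕ.+ n) ℕ.* (2 ℕ.+ n)) 4 (3 ℕ.+ n) (begin-strict
    4 ℕ.* suc n ℕ.* (3 ℕ.+ n)                      <⟨ ℕ.m<m+n _ (s≤s z≤n) ⟩
    4 ℕ.* suc n ℕ.* (3 ℕ.+ n) ℕ.+ 4 ℕ.* (3 ℕ.+ n)  ≡⟨ solve (n ∷ []) ⟩
    4 ℕ.* ((3 ℕ.+ n) ℕ.* (2 ℕ.+ n))                ∎))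
  where open ℕ.≤-Reasoning
q<4/k 1 (s≤s ())

q≤4/m : ∀ {k} m .{{_ : ℕ.NonZero m}} → 2 ℕ.≤ m → m ℕ.≤ k → q k ≤ + 4 / m
q≤4/m {k@(suc _)} m 2≤m m≤k =
  <⇒≤ (<-≤-trans (q<4/k k (ℕ.≤-trans 2≤m m≤k)) (*≤*⇒/≤/ 4 k 4 m (ℕ.*-monoʳ-≤ 4 m≤k)))
q≤4/m {zero} _ () z≤n

-- + 4 / 6 and + 4 / 12 normalise to + 2 / 3 and + 1 / 3, and + 1 / 3 + + 2 / 3
-- to 1ℚ, so the bounds below are used as they stand.

q≤2/3 : (k : ℕ) → k ≥ 2 → q k ≤ + 2 / 3
q≤2/3 2 _ = from-yes (q 2 ≤? + 2 / 3)
q≤2/3 3 _ = ≤-reflexive refl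
q≤2/3 4 _ = ≤-reflexive refl
q≤2/3 5 _ = from-yes (q 5 ≤? + 2 / 3)
q≤2/3 (suc (suc (suc (suc (suc (suc j)))))) _ = q≤4/m 6 (s≤s (s≤s z≤n)) (ℕ.m≤m+n 6 j)
q≤2/3 1 (s≤s ())

q+q≤1-below-12 : ∀ {a b} → a ℕ.< 12 → b ℕ.< 12 → 13 ℕ.≤ a ℕ.+ b → q a + q b ≤ 1ℚ
q+q≤1-below-12 a<12 = from-yes
  (allUpTo? (λ a → allUpTo? (λ b → (13 ℕ.≤? a ℕ.+ b) →-dec (q a + q b ≤? 1ℚ)) 12) 12) a<12

q+q≤1 : (a b : ℕ) → a ≥ 2 → b ≥ 2 → (a ℕ.+ b) ≥ 13 → (q a + q b) ≤ 1ℚ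
q+q≤1 a b 2≤a 2≤b 13≤a+b with 12 ℕ.≤? a | 12 ℕ.≤? b
... | yes 12≤a | _        = +-mono-≤ (q≤4/m 12 (s≤s (s≤s z≤n)) 12≤a) (q≤2/3 b 2≤b)
... | no _     | yes 12≤b = +-mono-≤ (q≤2/3 a 2≤a) (q≤4/m 12 (s≤s (s≤s z≤n)) 12≤b)
... | no 12≰a  | no 12≰b  = q+q≤1-below-12 (ℕ.≰⇒> 12≰a) (ℕ.≰⇒> 12≰b) 13≤a+b

lemma2p2 : ((k : ℕ) → .{{_ : ℕ.NonZero k}} → k ≥ 2 → q k < (+ 4 / k))
    × (((k : ℕ) → k ≥ 2 → q k ≤ (+ 2 / 3)) × (q 3 ≡ + 2 / 3) × (q 4 ≡ + 2 / 3))
    × ((a b : ℕ) → a ≥ 2 → b ≥ 2 → (a ℕ.+ b) ≥ 13 → (q a + q b) ≤ 1ℚ)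
lemma2p2 = q<4/k , (q≤2/3 , refl , refl) , q+q≤1
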